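{- Let $G$ be a finite irreducibly odd graph with girth $k$ (so $k \ge 3$). Then every cycle of length $k$ in $G$ is contained in a subgraph of $G$ isomorphic to the $k$-morningstar $M_k$, with that cycle as the cycle of $M_k$. That is, if $(v_1,\dots,v_k)$ is a $k$-cycle in $G$, then there exist $k$ distinct vertices $w_1,\dots,w_k$ of $G$, none in $\{v_1,\dots,v_k\}$, such that $w_i$ is adjacent to $v_i$ for each $i$.
   Context: All graphs are finite and simple. A graph is \emph{odd} if every vertex has odd degree. A graph $G$ is \emph{irreducibly odd} if it is odd and for every pair of distinct vertices $u,v$ of $G$ there exists a third vertex $w \notin \{u,v\}$ that is adjacent to exactly one of $u$ and $v$. The \emph{girth} of a graph is the minimum length of a cycle in it. For $n \ge 3$, the \emph{$n$-morningstar} $M_n$ is the graph on $2n$ vertices $v_1,\dots,v_n,w_1,\dots,w_n$ consisting of the cycle $v_1v_2\cdots v_nv_1$ together with the $n$ edges $v_iw_i$ (each $w_i$ has degree $1$). "Contains as a subgraph" means not necessarily induced. -}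

module Defs where

open import Data.Nat using (ℕ; zero; suc; _+_; _*_; _≤_)
open import Data.Bool using (Bool; true; false)
open import Data.Fin using (Fin; toℕ)
open import Data.List using (length; filter; allFin)
open import Data.Product using (Σ; ∃; _×_; _,_)
open import Data.Sum using (_⊎_)
open import Relation.Binary.PropositionalEquality using (_≡_; _≢_)
open import Relation.Nullary using (¬_)
open import Data.Bool.Properties using (T?)
open import Function.Definitions using (Injective)

record Graph (n : ℕ) : Set where
  field
    adj   : Fin n → Fin n → Bool
    sym   : ∀ u v → adj u v ≡ adj v u
    irref : ∀ u → adj u u ≡ false
open Graph public

Adj : ∀ {n} → Graph n → Fin n → Fin n → Set
Adj G u v = adj G u v ≡ true

degree : ∀ {n} → Graph n → Fin n → ℕ
degree {n} G u = length (filter (λ v → T? (adj G u v)) (allFin n))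

Odd : ℕ → Set
Odd m = ∃ λ k → m ≡ suc (2 * k)

IsOdd : ∀ {n} → Graph n → Set
IsOdd G = ∀ u → Odd (degree G u)

IrreduciblyOdd : ∀ {n} → Graph n → Set
IrreduciblyOdd {n} G =
  IsOdd G ×
  (∀ (u v : Fin n) → u ≢ v →
     ∃ λ w → w ≢ u × w ≢ v × adj G w u ≢ adj G w v)

CyclicSucc : (m : ℕ) → Fin m → Fin m → Set
CyclicSucc m i j = (suc (toℕ i) ≡ toℕ j) ⊎ (suc (toℕ i) ≡ m × toℕ j ≡ 0)

record Cycle {n} (G : Graph n) (m : ℕ) : Set where
  field
    len≥3  : 3 ≤ m
    vert   : Fin m → Fin n
    inj    : Injective _≡_ _≡_ vert
    edges  : ∀ i j → CyclicSucc m i j → Adj G (vert i) (vert j)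
open Cycle public

HasGirth : ∀ {n} → Graph n → ℕ → Set
HasGirth G k = Cycle G k × (∀ m → Cycle G m → k ≤ m)

module Submission where

-- Let C be a shortest cycle, of length k, in an irreducibly odd graph G, and
-- call Out i the set of neighbours of vertex i of C that are not on C.
-- Minimality of C gives two facts: C has no chords (a chord closes a shorter
-- cycle along an arc of C), and two distinct vertices of C with a common
-- neighbour x off C force k ≤ 4 (both detours through x around C are ≥ k).
-- By the first fact each vertex of C has exactly two neighbours on C, so by
-- odd degree Out i has odd size: it is a singleton or has three elements.
-- For k ≥ 5 the sets Out i are disjoint by the second fact, and any choice
-- of one element from each is injective.  For k = 3 (and opposite vertices
-- when k = 4) two vertices of C are told apart by no vertex of C, so by
-- irreducibility by a vertex off C; then Out i and Out j are not the same
-- singleton, and a small distinct-representatives argument finishes.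

open import Defs hiding (sym)
open import Data.Nat using (ℕ; zero; suc; _+_; _*_; _∸_; _≤_; _<_; z≤n; s≤s; s≤s⁻¹; z<s; NonZero; >-nonZero; _%_; _/_)
open import Data.Nat.Properties
open import Data.Nat.DivMod using (m%n<n; m%n≤n; m<n⇒m%n≡m; m≡m%n+[m/n]*n; [m+n]%n≡m%n; [m+kn]%n≡m%n; %-distribˡ-+; m%n%n≡m%n; n%n≡0)
open import Data.Bool using (T; true; false)
open import Data.Bool.Properties using (T?; T-≡) renaming (_≟_ to _≟ᵇ_)
open import Data.Fin using (Fin; toℕ; fromℕ; fromℕ<) renaming (zero to fzero; suc to fsuc)
open import Data.Fin.Properties using (toℕ-injective; toℕ-fromℕ; toℕ-fromℕ<; toℕ<n; any?) renaming (_≟_ to _≟ᶠ_)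
open import Data.List using (List; []; _∷_; length; filter; allFin)
open import Data.List.Membership.Propositional using (_∈_; _∉_)
open import Data.List.Membership.Propositional.Properties using (∈-filter⁺; ∈-filter⁻; ∈-allFin)
open import Data.List.Membership.Propositional.Properties.WithK using (unique∧set⇒bag)
import Data.List.Membership.DecPropositional as DecMembership
open import Data.List.Relation.Binary.BagAndSetEquality using (∼bag⇒↭)
open import Data.List.Relation.Binary.Permutation.Propositional.Properties using (↭-length)
open import Data.List.Relation.Unary.All as All using (All; []; _∷_)
open import Data.List.Relation.Unary.AllPairs using ([]; _∷_)
open import Data.List.Relation.Unary.Any using (here; there)
open import Data.List.Relation.Unary.Unique.Propositional using (Unique)
open import Data.List.Relation.Unary.Unique.Propositional.Properties using (filter⁺; allFin⁺)
open import Data.Vec using ([]; _∷_; lookup)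
open import Data.Vec.Relation.Unary.All using ([]; _∷_)
open import Data.Vec.Relation.Unary.AllPairs using ([]; _∷_)
open import Data.Vec.Relation.Unary.Unique.Propositional using () renaming (Unique to VecUnique)
open import Data.Vec.Relation.Unary.Unique.Propositional.Properties using (lookup-injective)
open import Data.Product using (∃; ∃₂; _×_; _,_; proj₁; proj₂)
open import Data.Sum using (_⊎_; inj₁; inj₂)
open import Data.Empty using (⊥; ⊥-elim)
open import Function.Bundles using (_⇔_; mk⇔; Equivalence)
open import Function.Properties.Equivalence using () renaming (trans to ⇔-trans; sym to ⇔-sym)
open import Function.Definitions using (Injective)
open import Relation.Nullary using (¬_; Dec; yes; no)
open import Relation.Nullary.Decidable using (_×-dec_; ¬?; decidable-stable)
open import Relation.Unary using (Decidable)
open import Relation.Binary.Definitions using (DecidableEquality)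
open import Relation.Binary.PropositionalEquality
  using (_≡_; _≢_; refl; sym; trans; cong; subst; subst₂; ≢-sym; module ≡-Reasoning)

adj-sym : ∀ {n} (G : Graph n) {u v} → Adj G u v → Adj G v u
adj-sym G {u} {v} uv = trans (Graph.sym G v u) uv

irreflexive : ∀ {n} (G : Graph n) {u} → ¬ Adj G u u
irreflexive G {u} uu with trans (sym uu) (irref G u)
... | ()

Distinguishing : ∀ {n} → Graph n → Set
Distinguishing {n} G = ∀ (u v : Fin n) → u ≢ v → ∃ λ w → w ≢ u × w ≢ v × adj G w u ≢ adj G w v

¬odd-double : ∀ m → ¬ Odd (2 * m)
¬odd-double m (j , 2m≡1+2j) = even≢odd m j 2m≡1+2j

_∈?_ : ∀ {n} (x : Fin n) (S : List (Fin n)) → Dec (x ∈ S)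
_∈?_ = DecMembership._∈?_ _≟ᶠ_

neighbours : ∀ {n} → Graph n → Fin n → List (Fin n)
neighbours {n} G u = filter (λ v → T? (adj G u v)) (allFin n)

∈-neighbours : ∀ {n} (G : Graph n) u {x} → x ∈ neighbours G u ⇔ Adj G u x
∈-neighbours {n} G u = mk⇔
  (λ x∈ → Equivalence.to T-≡ (proj₂ (∈-filter⁻ adjacent? {xs = allFin n} x∈)))
  (λ ux → ∈-filter⁺ adjacent? (∈-allFin _) (Equivalence.from T-≡ ux))
  where
  adjacent? : Decidable (λ v → T (adj G u v))
  adjacent? v = T? (adj G u v)

degree-≡-length : ∀ {n} (G : Graph n) u (S : List (Fin n)) → Unique S →
                  (∀ {x} → x ∈ S ⇔ Adj G u x) → degree G u ≡ length S
degree-≡-length {n} G u S unique-S S⇔ =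
  ↭-length (∼bag⇒↭ (unique∧set⇒bag unique-N unique-S (⇔-trans (∈-neighbours G u) (⇔-sym S⇔))))
  where
  unique-N : Unique (neighbours G u)
  unique-N = filter⁺ (λ v → T? (adj G u v)) (allFin⁺ n)

odd-escape : ∀ {n} (G : Graph n) u → Odd (degree G u) →
             (S : List (Fin n)) → Unique S → All (Adj G u) S → ¬ Odd (length S) →
             ∃ λ x → Adj G u x × x ∉ S
odd-escape G u odd S unique-S S-adjacent even
  with any? (λ x → (adj G u x ≟ᵇ true) ×-dec ¬? (x ∈? S))
... | yes found = found
... | no none = ⊥-elim (even (subst Odd (degree-≡-length G u S unique-S S⇔) odd))
  where
  S⇔ : ∀ {x} → x ∈ S ⇔ Adj G u x
  S⇔ {x} = mk⇔ (All.lookup S-adjacent) (λ ux → decidable-stable (x ∈? S) (λ x∉S → none (x , ux , x∉S)))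

both-ways-short : ∀ {k l} → l ≤ k → k ≤ 2 + l → k ≤ 2 + (k ∸ l) → k ≤ 4
both-ways-short {k} {l} l≤k onward back = ≤-trans onward (+-monoʳ-≤ 2 l≤2)
  where
  open ≤-Reasoning
  l≤2 : l ≤ 2
  l≤2 = +-cancelʳ-≤ k l 2 (begin
    l + k              ≡⟨ +-comm l k ⟩
    k + l              ≤⟨ +-monoˡ-≤ l back ⟩
    2 + (k ∸ l) + l    ≡⟨ +-assoc 2 (k ∸ l) l ⟩
    2 + (k ∸ l + l)    ≡⟨ cong (2 +_) (m∸n+n≡m l≤k) ⟩
    2 + k              ∎)

injective-by-≢ : ∀ {m} {A : Set} {f : Fin m → A} → (∀ {i j} → i ≢ j → f i ≢ f j) → Injective _≡_ _≡_ f
injective-by-≢ separates {i} {j} fi≡fj = decidable-stable (i ≟ᶠ j) (λ i≢j → separates i≢j fi≡fj)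

-- Distinct representatives for sets that are singletons or have three elements.

module DistinctRepresentatives {A : Set} (_≟_ : DecidableEquality A) where

  Only : (A → Set) → A → Set
  Only P x = P x × (∀ z → P z → z ≡ x)

  Triple : (A → Set) → Set
  Triple P = ∃ λ x → ∃ λ y → ∃ λ z → (P x × P y × P z) × (x ≢ y × x ≢ z × y ≢ z)

  -- the possible shapes of a set of odd size: a singleton, or at least three elements
  Shape : (A → Set) → Set
  Shape P = ∃ (Only P) ⊎ Triple P

  Apart : (A → Set) → (A → Set) → Set
  Apart P Q = ¬ ∃ λ x → Only P x × Only Q x

  member : ∀ {P} → Shape P → ∃ P
  member (inj₁ (x , px , _)) = x , px
  member (inj₂ (x , _ , _ , (px , _) , _)) = x , px

  avoid-one : ∀ {y z} → y ≢ z → ∀ c → y ≢ c ⊎ z ≢ c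
  avoid-one {y} y≢z c with y ≟ c
  ... | yes refl = inj₂ (≢-sym y≢z)
  ... | no y≢c = inj₁ y≢c

  avoid-two : ∀ {P} → Triple P → ∀ a b → ∃ λ w → P w × w ≢ a × w ≢ b
  avoid-two (x , y , z , (px , py , pz) , (x≢y , x≢z , y≢z)) a b with x ≟ a | x ≟ b
  ... | no x≢a | no x≢b = x , px , x≢a , x≢b
  ... | yes refl | _ with avoid-one y≢z b
  ...   | inj₁ y≢b = y , py , ≢-sym x≢y , y≢b
  ...   | inj₂ z≢b = z , pz , ≢-sym x≢z , z≢b
  avoid-two (x , y , z , (px , py , pz) , (x≢y , x≢z , y≢z)) a b | no _ | yes refl with avoid-one y≢z a
  ...   | inj₁ y≢a = y , py , y≢a , ≢-sym x≢y
  ...   | inj₂ z≢a = z , pz , z≢a , ≢-sym x≢z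

  representatives₂ : ∀ {P Q} → Shape P → Shape Q → Apart P Q → ∃₂ λ x y → P x × Q y × x ≢ y
  representatives₂ (inj₂ triple) shape-Q _ with member shape-Q
  ... | y , qy with avoid-two triple y y
  ...   | x , px , x≢y , _ = x , y , px , qy , x≢y
  representatives₂ (inj₁ (x , px , _)) (inj₂ triple) _ with avoid-two triple x x
  ... | y , qy , y≢x , _ = x , y , px , qy , ≢-sym y≢x
  representatives₂ (inj₁ (x , only-x)) (inj₁ (y , only-y)) apart =
    x , y , proj₁ only-x , proj₁ only-y , λ { refl → apart (x , only-x , only-y) }

  -- three pairwise apart such sets have distinct representatives: the
  -- singletons are distinct, and a triple can avoid the other two choices
  representatives₃ : ∀ {P Q R} → Shape P → Shape Q → Shape R → Apart P Q → Apart P R → Apart Q R →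
                     ∃ λ x → ∃ λ y → ∃ λ z → (P x × Q y × R z) × (x ≢ y × x ≢ z × y ≢ z)
  representatives₃ (inj₂ triple) sQ sR _ _ QR with representatives₂ sQ sR QR
  ... | y , z , qy , rz , y≢z with avoid-two triple y z
  ...   | x , px , x≢y , x≢z = x , y , z , (px , qy , rz) , (x≢y , x≢z , y≢z)
  representatives₃ sP (inj₂ triple) sR _ PR _ with representatives₂ sP sR PR
  ... | x , z , px , rz , x≢z with avoid-two triple x z
  ...   | y , qy , y≢x , y≢z = x , y , z , (px , qy , rz) , (≢-sym y≢x , x≢z , y≢z)
  representatives₃ sP sQ (inj₂ triple) PQ _ _ with representatives₂ sP sQ PQ
  ... | x , y , px , qy , x≢y with avoid-two triple x y
  ...   | z , rz , z≢x , z≢y = x , y , z , (px , qy , rz) , (x≢y , ≢-sym z≢x , ≢-sym z≢y)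
  representatives₃ (inj₁ (x , ox)) (inj₁ (y , oy)) (inj₁ (z , oz)) PQ PR QR =
    x , y , z , (proj₁ ox , proj₁ oy , proj₁ oz) ,
    ((λ { refl → PQ (x , ox , oy) }) , (λ { refl → PR (x , ox , oz) }) , (λ { refl → QR (y , oy , oz) }))

record Path {n} (G : Graph n) (l : ℕ) : Set where
  field
    at       : Fin (suc l) → Fin n
    distinct : Injective _≡_ _≡_ at
    step     : ∀ i j → suc (toℕ i) ≡ toℕ j → Adj G (at i) (at j)
open Path

close : ∀ {n} {G : Graph n} {l} (P : Path G l) → 2 ≤ l → Adj G (at P (fromℕ l)) (at P fzero) → Cycle G (suc l)
close {G = G} {l} P 2≤l closing = record
  { len≥3 = s≤s 2≤l ; vert = at P ; inj = distinct P ; edges = edges′ }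
  where
  edges′ : ∀ i j → CyclicSucc (suc l) i j → Adj G (at P i) (at P j)
  edges′ i j (inj₁ i→j) = step P i j i→j
  edges′ i j (inj₂ (i-last , j-first)) = subst₂ (λ a b → Adj G (at P a) (at P b)) (sym i≡last) (sym j≡first) closing
    where
    i≡last : i ≡ fromℕ l
    i≡last = toℕ-injective (trans (suc-injective i-last) (sym (toℕ-fromℕ l)))
    j≡first : j ≡ fzero
    j≡first = toℕ-injective j-first

extend : ∀ {n} {G : Graph n} {l} (P : Path G l) x → (∀ i → x ≢ at P i) → Adj G x (at P fzero) → Path G (suc l)
extend {n} {G} {l} P x new x~first = record { at = at′ ; distinct = distinct′ ; step = step′ }
  where
  at′ : Fin (suc (suc l)) → Fin n
  at′ fzero = x
  at′ (fsuc i) = at P i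
  distinct′ : Injective _≡_ _≡_ at′
  distinct′ {fzero} {fzero} _ = refl
  distinct′ {fzero} {fsuc j} x≡ = ⊥-elim (new j x≡)
  distinct′ {fsuc i} {fzero} ≡x = ⊥-elim (new i (sym ≡x))
  distinct′ {fsuc i} {fsuc j} e = cong fsuc (distinct P e)
  step′ : ∀ i j → suc (toℕ i) ≡ toℕ j → Adj G (at′ i) (at′ j)
  step′ fzero (fsuc fzero) _ = x~first
  step′ fzero (fsuc (fsuc j)) ()
  step′ (fsuc i) (fsuc j) e = step P i j (suc-injective e)

module OnCycle {n} {G : Graph n} {k} (C : Cycle G k) where

  open ≡-Reasoning

  1<k : 1 < k
  1<k = ≤-trans (s≤s (s≤s z≤n)) (len≥3 C)

  instance
    k-nonZero : NonZero k
    k-nonZero = >-nonZero (<-trans z<s 1<k)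

  position : ℕ → Fin k
  position t = fromℕ< (m%n<n t k)

  V : ℕ → Fin n
  V t = vert C (position t)

  toℕ-position : ∀ t → toℕ (position t) ≡ t % k
  toℕ-position t = toℕ-fromℕ< (m%n<n t k)

  V-mod : ∀ {s t} → s % k ≡ t % k → V s ≡ V t
  V-mod s≡t = cong (vert C) (toℕ-injective (trans (toℕ-position _) (trans s≡t (sym (toℕ-position _)))))

  V-mod⁻ : ∀ {s t} → V s ≡ V t → s % k ≡ t % k
  V-mod⁻ Vs≡Vt = trans (sym (toℕ-position _)) (trans (cong toℕ (inj C Vs≡Vt)) (toℕ-position _))

  V-toℕ : ∀ i → V (toℕ i) ≡ vert C i
  V-toℕ i = cong (vert C) (toℕ-injective (trans (toℕ-position _) (m<n⇒m%n≡m (toℕ<n i))))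

  V-periodic : ∀ t → V (t + k) ≡ V t
  V-periodic t = V-mod ([m+n]%n≡m%n t k)

  V-step : ∀ t → Adj G (V t) (V (suc t))
  V-step t = edges C _ _ successor
    where
    suc-% : suc t % k ≡ suc (t % k) % k
    suc-% = trans (%-distribˡ-+ 1 t k) (cong (λ z → (z + t % k) % k) (m<n⇒m%n≡m 1<k))
    successor : CyclicSucc k (position t) (position (suc t))
    successor with m≤n⇒m<n∨m≡n (m%n<n t k)
    ... | inj₁ no-wrap = inj₁ (begin
      suc (toℕ (position t))    ≡⟨ cong suc (toℕ-position t) ⟩
      suc (t % k)               ≡⟨ sym (m<n⇒m%n≡m no-wrap) ⟩
      suc (t % k) % k           ≡⟨ sym suc-% ⟩
      suc t % k                 ≡⟨ sym (toℕ-position (suc t)) ⟩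
      toℕ (position (suc t))    ∎)
    ... | inj₂ wrap = inj₂ (trans (cong suc (toℕ-position t)) wrap , (begin
      toℕ (position (suc t))    ≡⟨ toℕ-position (suc t) ⟩
      suc t % k                 ≡⟨ suc-% ⟩
      suc (t % k) % k           ≡⟨ cong (_% k) wrap ⟩
      k % k                     ≡⟨ n%n≡0 k ⟩
      0                         ∎))

  -- going undo s further from position s lands on a multiple of k
  undo : ℕ → ℕ
  undo s = k ∸ s % k

  undo-+ : ∀ s → undo s + s ≡ suc (s / k) * k
  undo-+ s = begin
    undo s + s                        ≡⟨ cong (undo s +_) (m≡m%n+[m/n]*n s k) ⟩
    undo s + (s % k + s / k * k)      ≡⟨ sym (+-assoc (undo s) (s % k) _) ⟩
    (undo s + s % k) + s / k * k      ≡⟨ cong (_+ s / k * k) (m∸n+n≡m (m%n≤n s k)) ⟩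
    k + s / k * k                     ∎

  undo-cancels : ∀ s t → (undo s + s + t) % k ≡ t % k
  undo-cancels s t = begin
    (undo s + s + t) % k              ≡⟨ cong (λ m → (m + t) % k) (undo-+ s) ⟩
    (suc (s / k) * k + t) % k         ≡⟨ cong (_% k) (+-comm (suc (s / k) * k) t) ⟩
    (t + suc (s / k) * k) % k         ≡⟨ [m+kn]%n≡m%n t (suc (s / k)) k ⟩
    t % k                             ∎

  window-injective : ∀ s {a b} → a < k → b < k → V (s + a) ≡ V (s + b) → a ≡ b
  window-injective s {a} {b} a<k b<k Va≡Vb = begin
    a                                  ≡⟨ sym (m<n⇒m%n≡m a<k) ⟩
    a % k                              ≡⟨ sym (undo-cancels s a) ⟩
    (undo s + s + a) % k               ≡⟨ cong (_% k) (+-assoc (undo s) s a) ⟩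
    (undo s + (s + a)) % k             ≡⟨ %-distribˡ-+ (undo s) (s + a) k ⟩
    (undo s % k + (s + a) % k) % k     ≡⟨ cong (λ z → (undo s % k + z) % k) (V-mod⁻ Va≡Vb) ⟩
    (undo s % k + (s + b) % k) % k     ≡⟨ sym (%-distribˡ-+ (undo s) (s + b) k) ⟩
    (undo s + (s + b)) % k             ≡⟨ cong (_% k) (sym (+-assoc (undo s) s b)) ⟩
    (undo s + s + b) % k               ≡⟨ undo-cancels s b ⟩
    b % k                              ≡⟨ m<n⇒m%n≡m b<k ⟩
    b                                  ∎

  window-covers : ∀ s j → ∃ λ l → l < k × V (s + l) ≡ vert C j
  window-covers s j = l , m%n<n _ k , trans (V-mod lands) (V-toℕ j)
    where
    l : ℕ
    l = (undo s + toℕ j) % k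
    lands : (s + l) % k ≡ toℕ j % k
    lands = begin
      (s + l) % k                            ≡⟨ %-distribˡ-+ s l k ⟩
      (s % k + l % k) % k                    ≡⟨ cong (λ z → (s % k + z) % k) (m%n%n≡m%n _ k) ⟩
      (s % k + (undo s + toℕ j) % k) % k     ≡⟨ sym (%-distribˡ-+ s (undo s + toℕ j) k) ⟩
      (s + (undo s + toℕ j)) % k             ≡⟨ cong (_% k) (sym (+-assoc s (undo s) (toℕ j))) ⟩
      (s + undo s + toℕ j) % k               ≡⟨ cong (λ m → (m + toℕ j) % k) (+-comm s (undo s)) ⟩
      (undo s + s + toℕ j) % k               ≡⟨ undo-cancels s (toℕ j) ⟩
      toℕ j % k                              ∎

  arc : ∀ s l → l < k → Path G l
  arc s l l<k = record { at = λ i → V (s + toℕ i) ; distinct = distinct′ ; step = step′ }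
    where
    bound : ∀ (i : Fin (suc l)) → toℕ i < k
    bound i = ≤-<-trans (s≤s⁻¹ (toℕ<n i)) l<k
    distinct′ : Injective _≡_ _≡_ (λ i → V (s + toℕ i))
    distinct′ {i} {j} e = toℕ-injective (window-injective s (bound i) (bound j) e)
    step′ : ∀ i j → suc (toℕ i) ≡ toℕ j → Adj G (V (s + toℕ i)) (V (s + toℕ j))
    step′ i j i→j = subst (λ t → Adj G (V (s + toℕ i)) (V t))
                          (trans (sym (+-suc s (toℕ i))) (cong (s +_) i→j)) (V-step (s + toℕ i))

  arc-first : ∀ s l (l<k : l < k) → at (arc s l l<k) fzero ≡ V s
  arc-first s _ _ = cong V (+-identityʳ s)

  arc-last : ∀ s l (l<k : l < k) → at (arc s l l<k) (fromℕ l) ≡ V (s + l)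
  arc-last s l _ = cong (λ t → V (s + t)) (toℕ-fromℕ l)

  next prev : Fin k → Fin n
  next i = V (suc (toℕ i))
  prev i = V (toℕ i + (k ∸ 1))

  adj-next : ∀ i → Adj G (vert C i) (next i)
  adj-next i = subst (λ v → Adj G v (next i)) (V-toℕ i) (V-step (toℕ i))

  adj-prev : ∀ i → Adj G (vert C i) (prev i)
  adj-prev i = adj-sym G (subst (Adj G (prev i)) (trans around (V-toℕ i)) (V-step (toℕ i + (k ∸ 1))))
    where
    around : V (suc (toℕ i + (k ∸ 1))) ≡ V (toℕ i)
    around = trans (cong V (trans (sym (+-suc (toℕ i) (k ∸ 1))) (cong (toℕ i +_) (m+[n∸m]≡n (<⇒≤ 1<k)))))
                   (V-periodic (toℕ i))

  next≢prev : ∀ i → next i ≢ prev i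
  next≢prev i same = <⇒≢ (∸-monoˡ-≤ 1 (len≥3 C)) (window-injective (toℕ i) 1<k k∸1<k
                       (trans (cong V (+-comm (toℕ i) 1)) same))
    where
    k∸1<k : k ∸ 1 < k
    k∸1<k = ∸-monoʳ-< z<s (<⇒≤ 1<k)

  Outside : Fin n → Set
  Outside x = ∀ j → x ≢ vert C j

  outside? : Decidable Outside
  outside? x with any? (λ j → x ≟ᶠ vert C j)
  ... | yes (j , x≡j) = no (λ outside → outside j x≡j)
  ... | no none = yes (λ j x≡j → none (j , x≡j))

  Out : Fin k → Fin n → Set
  Out i x = Adj G (vert C i) x × Outside x

  out? : ∀ i → Decidable (Out i)
  out? i x = (adj G (vert C i) x ≟ᵇ true) ×-dec outside? x

  off-C : ∀ {i x} → Out i x → ∀ t → V t ≢ x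
  off-C (_ , outside) t Vt≡x = outside (position t) (sym Vt≡x)

  open DistinctRepresentatives (_≟ᶠ_ {n}) public

  flanked : ∀ c → adj G (vert C c) (prev c) ≡ adj G (vert C c) (next c)
  flanked c = trans (adj-prev c) (sym (adj-next c))

  -- if no other vertex of C distinguishes the vertices i and j of C, the
  -- vertex w distinguishing them lies off C; hence Out i and Out j are not
  -- the same singleton, for w lies in exactly one of them
  apart : Distinguishing G → ∀ i j → i ≢ j →
          (∀ c → c ≢ i → c ≢ j → adj G (vert C c) (vert C i) ≡ adj G (vert C c) (vert C j)) →
          Apart (Out i) (Out j)
  apart distinguishing i j i≢j agree = separated-by (distinguishing (vert C i) (vert C j) (λ i≡j → i≢j (inj C i≡j)))
    where
    separated-by : (∃ λ w → w ≢ vert C i × w ≢ vert C j × adj G w (vert C i) ≢ adj G w (vert C j)) →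
                   Apart (Out i) (Out j)
    separated-by (w , w≢i , w≢j , distinguishes) (x , (x-out-i , only-i) , (x-out-j , only-j)) =
      by-cases (adj G (vert C i) w) (adj G (vert C j) w) refl refl
      where
      w-outside : Outside w
      w-outside c w≡c with c ≟ᶠ i | c ≟ᶠ j
      ... | yes refl | _ = w≢i w≡c
      ... | no _ | yes refl = w≢j w≡c
      ... | no c≢i | no c≢j =
        distinguishes (subst (λ v → adj G v (vert C i) ≡ adj G v (vert C j)) (sym w≡c) (agree c c≢i c≢j))
      seen-alike : ∀ {b} → adj G (vert C i) w ≡ b → adj G (vert C j) w ≡ b → adj G w (vert C i) ≡ adj G w (vert C j)
      seen-alike i~w j~w = trans (Graph.sym G w (vert C i)) (trans i~w (sym (trans (Graph.sym G w (vert C j)) j~w)))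
      adj-to : ∀ {u} → w ≡ x → Adj G u x → Adj G u w
      adj-to refl u~x = u~x
      -- w is adjacent to exactly one of i, j, so it is an outside neighbour of
      -- that one, hence equal to x, hence adjacent to the other one as well
      by-cases : ∀ bi bj → adj G (vert C i) w ≡ bi → adj G (vert C j) w ≡ bj → ⊥
      by-cases true  true  i~w j~w = distinguishes (seen-alike i~w j~w)
      by-cases false false i~w j~w = distinguishes (seen-alike i~w j~w)
      by-cases true  false i~w _   = distinguishes (seen-alike i~w (adj-to (only-i w (i~w , w-outside)) (proj₁ x-out-j)))
      by-cases false true  _   j~w = distinguishes (seen-alike (adj-to (only-j w (j~w , w-outside)) (proj₁ x-out-i)) j~w)

  Morningstar : Set
  Morningstar = ∃ λ (w : Fin k → Fin n) → Injective _≡_ _≡_ w × (∀ i → Out i (w i))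

-- Consequences of C being a shortest cycle.

module ShortestCycle {n} {G : Graph n} {k} (C : Cycle G k) (shortest : ∀ m → Cycle G m → k ≤ m) where

  open OnCycle C

  -- a chord from V s to V (s + l) closes a cycle of length l + 1
  chord-length : ∀ s l → 2 ≤ l → l < k → Adj G (V s) (V (s + l)) → k ≤ suc l
  chord-length s l 2≤l l<k chord = shortest _ (close (arc s l l<k) 2≤l closing)
    where
    closing : Adj G (at (arc s l l<k) (fromℕ l)) (at (arc s l l<k) fzero)
    closing = subst₂ (Adj G) (sym (arc-last s l l<k)) (sym (arc-first s l l<k)) (adj-sym G chord)

  -- a vertex x off C adjacent to V s and V (s + l) closes a cycle of length l + 2
  detour-length : ∀ s l x → 1 ≤ l → l < k → Outside x → Adj G (V s) x → Adj G (V (s + l)) x → k ≤ suc (suc l)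
  detour-length s l x 1≤l l<k outside s~x s+l~x =
    shortest _ (close (extend (arc s l l<k) x (λ i → outside (position _)) x~first) (s≤s 1≤l) last~x)
    where
    x~first : Adj G x (at (arc s l l<k) fzero)
    x~first = subst (Adj G x) (sym (arc-first s l l<k)) (adj-sym G s~x)
    last~x : Adj G (at (arc s l l<k) (fromℕ l)) x
    last~x = subst (λ v → Adj G v x) (sym (arc-last s l l<k)) s+l~x

  chordless : ∀ s j → Adj G (V s) (vert C j) → vert C j ≡ V (suc s) ⊎ vert C j ≡ V (s + (k ∸ 1))
  chordless s j s~j with window-covers s j
  ... | zero , _ , at-0 = ⊥-elim (irreflexive G (subst (Adj G (V s)) (trans (sym at-0) (cong V (+-identityʳ s))) s~j))
  ... | suc zero , _ , at-1 = inj₁ (trans (sym at-1) (cong V (+-comm s 1)))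
  ... | l@(suc (suc _)) , l<k , at-l = inj₂ (trans (sym at-l) (cong (λ m → V (s + m)) l≡k∸1))
    where
    k≤1+l : k ≤ suc l
    k≤1+l = chord-length s l (s≤s (s≤s z≤n)) l<k (subst (Adj G (V s)) (sym at-l) s~j)
    l≡k∸1 : l ≡ k ∸ 1
    l≡k∸1 = cong (_∸ 1) (≤-antisym l<k k≤1+l)

  -- two distinct vertices of C with a common neighbour off C force k ≤ 4:
  -- both ways around C from one to the other, the detour through it is ≥ k
  shared-outside-neighbour : ∀ i j x → i ≢ j → Outside x → Adj G (vert C i) x → Adj G (vert C j) x → k ≤ 4
  shared-outside-neighbour i j x i≢j outside i~x j~x with window-covers (toℕ i) j
  ... | zero , _ , at-0 = ⊥-elim (i≢j (inj C (trans (sym (V-toℕ i)) (trans (cong V (sym (+-identityʳ _))) at-0))))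
  ... | l@(suc _) , l<k , at-l = both-ways-short (<⇒≤ l<k) onward back
    where
    s : ℕ
    s = toℕ i
    s~x : Adj G (V s) x
    s~x = subst (λ v → Adj G v x) (sym (V-toℕ i)) i~x
    s+l~x : Adj G (V (s + l)) x
    s+l~x = subst (λ v → Adj G v x) (sym at-l) j~x
    around : V (s + l + (k ∸ l)) ≡ V s
    around = trans (cong V (trans (+-assoc s l (k ∸ l)) (cong (s +_) (m+[n∸m]≡n (<⇒≤ l<k))))) (V-periodic s)
    onward : k ≤ 2 + l
    onward = detour-length s l x (s≤s z≤n) l<k outside s~x s+l~x
    back : k ≤ 2 + (k ∸ l)
    back = detour-length (s + l) (k ∸ l) x (m<n⇒0<n∸m l<k) (∸-monoʳ-< z<s (<⇒≤ l<k)) outside s+l~x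
             (subst (λ v → Adj G v x) (sym around) s~x)

  module _ (odd : IsOdd G) where

    out-escape : ∀ i (S : List (Fin n)) → Unique S → All (Adj G (vert C i)) S → ¬ Odd (length S) →
                 next i ∈ S → prev i ∈ S → ∃ λ x → Out i x × x ∉ S
    out-escape i S unique-S S-adjacent even next∈S prev∈S
      with odd-escape G (vert C i) (odd (vert C i)) S unique-S S-adjacent even
    ... | x , i~x , x∉S = x , (i~x , outside) , x∉S
      where
      outside : Outside x
      outside j x≡j with chordless (toℕ i) j (subst₂ (Adj G) (sym (V-toℕ i)) x≡j i~x)
      ... | inj₁ j-next = x∉S (subst (_∈ S) (sym (trans x≡j j-next)) next∈S)
      ... | inj₂ j-prev = x∉S (subst (_∈ S) (sym (trans x≡j j-prev)) prev∈S)

    -- every vertex of C has a neighbour off C, since its degree is odd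
    Out-nonempty : ∀ i → ∃ (Out i)
    Out-nonempty i with out-escape i (next i ∷ prev i ∷ []) ((next≢prev i ∷ []) ∷ [] ∷ [])
                          (adj-next i ∷ adj-prev i ∷ []) (¬odd-double 1) (here refl) (there (here refl))
    ... | x , out-x , _ = x , out-x

    -- … and if it has two, it has a third, since its degree is not 4
    Out-third : ∀ i x y → x ≢ y → Out i x → Out i y → ∃ λ z → Out i z × z ≢ x × z ≢ y
    Out-third i x y x≢y out-x out-y
      with out-escape i S unique-S (adj-next i ∷ adj-prev i ∷ proj₁ out-x ∷ proj₁ out-y ∷ [])
                      (¬odd-double 2) (here refl) (there (here refl))
      where
      S : List (Fin n)
      S = next i ∷ prev i ∷ x ∷ y ∷ []
      unique-S : Unique S
      unique-S = (next≢prev i ∷ off-C out-x _ ∷ off-C out-y _ ∷ [])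
               ∷ (off-C out-x _ ∷ off-C out-y _ ∷ []) ∷ (x≢y ∷ []) ∷ [] ∷ []
    ... | z , out-z , z∉S = z , out-z , (λ z≡x → z∉S (there (there (here z≡x))))
                                      , (λ z≡y → z∉S (there (there (there (here z≡y)))))

    Out-shape : ∀ i → Shape (Out i)
    Out-shape i with Out-nonempty i
    ... | x , out-x with any? (λ y → out? i y ×-dec ¬? (y ≟ᶠ x))
    ...   | no none = inj₁ (x , out-x , λ z out-z → decidable-stable (z ≟ᶠ x) (λ z≢x → none (z , out-z , z≢x)))
    ...   | yes (y , out-y , y≢x) with Out-third i x y (≢-sym y≢x) out-x out-y
    ...     | z , out-z , z≢x , z≢y =
              inj₂ (x , y , z , (out-x , out-y , out-z) , (≢-sym y≢x , ≢-sym z≢x , ≢-sym z≢y))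

-- k ≥ 5: the sets Out i are pairwise disjoint, so any choice from them is injective
long-morningstar : ∀ {n} {G : Graph n} {k} (C : Cycle G k) → (∀ m → Cycle G m → k ≤ m) →
                   IsOdd G → 5 ≤ k → OnCycle.Morningstar C
long-morningstar {n} {G} {k} C shortest odd 5≤k = w , injective-by-≢ separated , out-w
  where
  open OnCycle C
  open ShortestCycle C shortest
  w : Fin k → Fin n
  w i = proj₁ (Out-nonempty odd i)
  out-w : ∀ i → Out i (w i)
  out-w i = proj₂ (Out-nonempty odd i)
  separated : ∀ {i j} → i ≢ j → w i ≢ w j
  separated {i} {j} i≢j wi≡wj = ≤⇒≯ (shared-outside-neighbour i j (w i) i≢j (proj₂ (out-w i)) (proj₁ (out-w i))
                                       (subst (Adj G (vert C j)) (sym wi≡wj) (proj₁ (out-w j)))) 5≤k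

-- k = 3: any two vertices of the triangle are told apart only off C
triangle-morningstar : ∀ {n} {G : Graph n} (C : Cycle G 3) → (∀ m → Cycle G m → 3 ≤ m) →
                       IrreduciblyOdd G → OnCycle.Morningstar C
triangle-morningstar {G = G} C shortest (odd , distinguishing) =
  from-representatives (representatives₃ (Out-shape odd v₀) (Out-shape odd v₁) (Out-shape odd v₂)
                                          (apart′ v₀ v₁ (λ ())) (apart′ v₀ v₂ (λ ())) (apart′ v₁ v₂ (λ ())))
  where
  open OnCycle C
  open ShortestCycle C shortest
  v₀ v₁ v₂ : Fin 3
  v₀ = fzero
  v₁ = fsuc fzero
  v₂ = fsuc (fsuc fzero)
  adjacent : ∀ c i → c ≢ i → Adj G (vert C c) (vert C i)
  adjacent fzero fzero c≢i = ⊥-elim (c≢i refl)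
  adjacent fzero (fsuc fzero) _ = adj-next v₀
  adjacent fzero (fsuc (fsuc fzero)) _ = adj-prev v₀
  adjacent (fsuc fzero) fzero _ = adj-prev v₁
  adjacent (fsuc fzero) (fsuc fzero) c≢i = ⊥-elim (c≢i refl)
  adjacent (fsuc fzero) (fsuc (fsuc fzero)) _ = adj-next v₁
  adjacent (fsuc (fsuc fzero)) fzero _ = adj-next v₂
  adjacent (fsuc (fsuc fzero)) (fsuc fzero) _ = adj-prev v₂
  adjacent (fsuc (fsuc fzero)) (fsuc (fsuc fzero)) c≢i = ⊥-elim (c≢i refl)
  apart′ : ∀ i j → i ≢ j → Apart (Out i) (Out j)
  apart′ i j i≢j = apart distinguishing i j i≢j (λ c c≢i c≢j → trans (adjacent c i c≢i) (sym (adjacent c j c≢j)))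
  from-representatives : (∃ λ x → ∃ λ y → ∃ λ z → (Out v₀ x × Out v₁ y × Out v₂ z) × (x ≢ y × x ≢ z × y ≢ z)) →
                         Morningstar
  from-representatives (x , y , z , (out-x , out-y , out-z) , (x≢y , x≢z , y≢z)) =
    lookup (x ∷ y ∷ z ∷ []) , (λ {i} {j} → lookup-injective pairwise-distinct i j) , outs
    where
    pairwise-distinct : VecUnique (x ∷ y ∷ z ∷ [])
    pairwise-distinct = (x≢y ∷ x≢z ∷ []) ∷ (y≢z ∷ []) ∷ [] ∷ []
    outs : ∀ i → Out i (lookup (x ∷ y ∷ z ∷ []) i)
    outs fzero = out-x
    outs (fsuc fzero) = out-y
    outs (fsuc (fsuc fzero)) = out-z

-- k = 4: opposite vertices are told apart only off C, and consecutive
-- vertices have no common neighbour off C, as there are no triangles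
square-morningstar : ∀ {n} {G : Graph n} (C : Cycle G 4) → (∀ m → Cycle G m → 4 ≤ m) →
                     IrreduciblyOdd G → OnCycle.Morningstar C
square-morningstar {G = G} C shortest (odd , distinguishing) =
  from-representatives (representatives₂ (Out-shape odd v₀) (Out-shape odd v₂) (apart distinguishing v₀ v₂ (λ ()) agree₀₂))
                       (representatives₂ (Out-shape odd v₁) (Out-shape odd v₃) (apart distinguishing v₁ v₃ (λ ()) agree₁₃))
  where
  open OnCycle C
  open ShortestCycle C shortest
  v₀ v₁ v₂ v₃ : Fin 4
  v₀ = fzero
  v₁ = fsuc fzero
  v₂ = fsuc (fsuc fzero)
  v₃ = fsuc (fsuc (fsuc fzero))
  -- besides v₀ and v₂ there are v₁ and v₃, each flanked by v₀ and v₂; and symmetrically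
  agree₀₂ : ∀ c → c ≢ v₀ → c ≢ v₂ → adj G (vert C c) (vert C v₀) ≡ adj G (vert C c) (vert C v₂)
  agree₀₂ fzero c≢v₀ _ = ⊥-elim (c≢v₀ refl)
  agree₀₂ (fsuc fzero) _ _ = flanked v₁
  agree₀₂ (fsuc (fsuc fzero)) _ c≢v₂ = ⊥-elim (c≢v₂ refl)
  agree₀₂ (fsuc (fsuc (fsuc fzero))) _ _ = sym (flanked v₃)
  agree₁₃ : ∀ c → c ≢ v₁ → c ≢ v₃ → adj G (vert C c) (vert C v₁) ≡ adj G (vert C c) (vert C v₃)
  agree₁₃ fzero _ _ = sym (flanked v₀)
  agree₁₃ (fsuc fzero) c≢v₁ _ = ⊥-elim (c≢v₁ refl)
  agree₁₃ (fsuc (fsuc fzero)) _ _ = flanked v₂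
  agree₁₃ (fsuc (fsuc (fsuc fzero))) _ c≢v₃ = ⊥-elim (c≢v₃ refl)
  -- an outside neighbour of V s and V (s + 1) would close a triangle
  no-triangle : ∀ s {x} → Out (position s) x → Adj G (V (s + 1)) x → ⊥
  no-triangle s out-x s+1~x =
    ≤⇒≯ (detour-length s 1 _ (s≤s z≤n) (s≤s (s≤s z≤n)) (proj₂ out-x) (proj₁ out-x) s+1~x) ≤-refl
  from-representatives : (∃₂ λ a c → Out v₀ a × Out v₂ c × a ≢ c) → (∃₂ λ b d → Out v₁ b × Out v₃ d × b ≢ d) →
                         Morningstar
  from-representatives (a , c , out-a , out-c , a≢c) (b , d , out-b , out-d , b≢d) =
    lookup (a ∷ b ∷ c ∷ d ∷ []) , (λ {i} {j} → lookup-injective pairwise-distinct i j) , outs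
    where
    pairwise-distinct : VecUnique (a ∷ b ∷ c ∷ d ∷ [])
    pairwise-distinct =
        ((λ { refl → no-triangle 0 out-a (proj₁ out-b) }) ∷ a≢c ∷ (λ { refl → no-triangle 3 out-d (proj₁ out-a) }) ∷ [])
      ∷ ((λ { refl → no-triangle 1 out-b (proj₁ out-c) }) ∷ b≢d ∷ [])
      ∷ ((λ { refl → no-triangle 2 out-c (proj₁ out-d) }) ∷ [])
      ∷ [] ∷ []
    outs : ∀ i → Out i (lookup (a ∷ b ∷ c ∷ d ∷ []) i)
    outs fzero = out-a
    outs (fsuc fzero) = out-b
    outs (fsuc (fsuc fzero)) = out-c
    outs (fsuc (fsuc (fsuc fzero))) = out-d

morningstar : ∀ {n} {G : Graph n} {k} (C : Cycle G k) → (∀ m → Cycle G m → k ≤ m) →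
              IrreduciblyOdd G → OnCycle.Morningstar C
morningstar {k = 0} C _ _ = ⊥-elim (≤⇒≯ z≤n (len≥3 C))
morningstar {k = 1} C _ _ = ⊥-elim (≤⇒≯ (s≤s z≤n) (len≥3 C))
morningstar {k = 2} C _ _ = ⊥-elim (≤⇒≯ ≤-refl (len≥3 C))
morningstar {k = 3} C shortest io = triangle-morningstar C shortest io
morningstar {k = 4} C shortest io = square-morningstar C shortest io
morningstar {k = suc (suc (suc (suc (suc _))))} C shortest (odd , _) =
  long-morningstar C shortest odd (s≤s (s≤s (s≤s (s≤s (s≤s z≤n)))))

theorem3p2 : ∀ {n} (G : Graph n) (k : ℕ) → IrreduciblyOdd G → HasGirth G k →
    (C : Cycle G k) →
    ∃ λ (w : Fin k → Fin n) →
      Injective _≡_ _≡_ w ×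
      (∀ i j → w i ≢ vert C j) ×
      (∀ i → Adj G (vert C i) (w i))
theorem3p2 G k io (_ , shortest) C with morningstar C shortest io
... | w , w-injective , w-out = w , w-injective , (λ i → proj₂ (w-out i)) , (λ i → proj₁ (w-out i))
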